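{- Let $\underline L=(L,B)$ be an even integral lattice of rank $n\ge1$, $Q(v)=\frac12B(v,v)$. Let $a,b,c,d\in\mathbb{Z}$ with $ad-bc=1$ and $d\ne0$, and let $w\in L^\sharp$ with $bcw\in L$. Then $$\mathfrak G_{\underline L}(b/d;w)=e\big(a^2bd\,Q(w)\big)\,\mathfrak G_{\underline L}(b/d;0).$$
   Context: $e(z)=\exp(2\pi i z)$. A lattice $\underline L=(L,B)$ is a free $\mathbb{Z}$-module of finite rank $n$ with a nondegenerate symmetric bilinear form $B$ (extended bilinearly to $\mathbb{Q}\otimes L$); it is even integral if $Q(L)\subseteq\mathbb{Z}$. $L^\sharp=\{x\in\mathbb{Q}\otimes L: B(x,L)\subseteq\mathbb{Z}\}$. For coprime integers $\alpha,\beta$ with $\beta\ne0$ and $w\in L^\sharp$, $\mathfrak G_{\underline L}(\alpha/\beta;w)=|\beta|^{ -n/2}\sum_{v\in L/\beta L}e\big(\frac\alpha\beta Q(w+v)\big)$ (well defined). -}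

module Defs where

open import Level using (Level)
open import Data.Nat using (ℕ; zero; suc)
open import Data.Fin using (Fin; toℕ) renaming (zero to fz; suc to fs)
open import Data.Integer as ℤ using (ℤ; +_)
open import Data.Rational as ℚ using (ℚ; ½; 0ℚ; _/_)
open import Data.Product using (∃-syntax; Σ-syntax)
open import Relation.Binary.PropositionalEquality using (_≡_)
open import Algebra.Bundles using (CommutativeRing)

ι : ℤ → ℚ
ι z = z / 1

-- α/β as a rational (only used for β ≠ 0; value at β = 0 is a junk 0)
frac : ℤ → ℤ → ℚ
frac α (+ zero) = 0ℚ
frac α (+ suc k) = α / suc k
frac α ℤ.-[1+ k ] = (ℤ.- α) / suc k

IsInt : ℚ → Set
IsInt q = ∃[ z ] q ≡ ι z

sumℚ : (n : ℕ) → (Fin n → ℚ) → ℚ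
sumℚ zero f = 0ℚ
sumℚ (suc n) f = f fz ℚ.+ sumℚ n (λ i → f (fs i))

-- The lattice L is modelled as ℤⁿ (coordinates w.r.t. a ℤ-basis), ℚ⊗L as ℚⁿ,
-- and the bilinear form B by its symmetric Gram matrix G : Fin n → Fin n → ℚ.
Gram : ℕ → Set
Gram n = Fin n → Fin n → ℚ

embed : {n : ℕ} → (Fin n → ℤ) → (Fin n → ℚ)
embed x i = ι (x i)

Bf : {n : ℕ} → Gram n → (Fin n → ℚ) → (Fin n → ℚ) → ℚ
Bf {n} G x y = sumℚ n (λ i → sumℚ n (λ j → x i ℚ.* (G i j ℚ.* y j)))

Qf : {n : ℕ} → Gram n → (Fin n → ℚ) → ℚ
Qf G x = ½ ℚ.* Bf G x x

addV : {n : ℕ} → (Fin n → ℚ) → (Fin n → ℚ) → (Fin n → ℚ)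
addV x y i = x i ℚ.+ y i

Symmetric : {n : ℕ} → Gram n → Set
Symmetric G = ∀ i j → G i j ≡ G j i

Nondegenerate : {n : ℕ} → Gram n → Set
Nondegenerate {n} G = (x : Fin n → ℚ) → ((y : Fin n → ℤ) → Bf G x (embed y) ≡ 0ℚ) → ∀ i → x i ≡ 0ℚ

EvenIntegral : {n : ℕ} → Gram n → Set
EvenIntegral {n} G = (x : Fin n → ℤ) → IsInt (Qf G (embed x))

InDual : {n : ℕ} → Gram n → (Fin n → ℚ) → Set
InDual {n} G w = (y : Fin n → ℤ) → IsInt (Bf G w (embed y))

InL : {n : ℕ} → (Fin n → ℚ) → Set
InL {n} w = Σ[ z ∈ (Fin n → ℤ) ] ((i : Fin n) → w i ≡ ι (z i))

scaleV : {n : ℕ} → ℚ → (Fin n → ℚ) → (Fin n → ℚ)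
scaleV q w i = q ℚ.* w i

module _ {c ℓ : Level} (R : CommutativeRing c ℓ) where
  open CommutativeRing R using (_≈_; _+_; _*_; 0#; 1#) renaming (Carrier to A)

  -- a character of ℚ/ℤ with values in R (e.g. e(z)=exp(2πiz) into ℂ)
  record Character : Set (c Level.⊔ ℓ) where
    field
      χ      : ℚ → A
      χ-add  : ∀ x y → χ (x ℚ.+ y) ≈ χ x * χ y
      χ-int  : ∀ z → χ (ι z) ≈ 1#

  sumR : (n : ℕ) → (Fin n → A) → A
  sumR zero f = 0#
  sumR (suc n) f = f fz + sumR n (λ i → f (fs i))

  consF : {n m : ℕ} → Fin m → (Fin n → Fin m) → (Fin (suc n) → Fin m)
  consF k v fz = k
  consF k v (fs i) = v i

  -- sum over all vectors in {0,…,m-1}ⁿ (a system of representatives of L/mL)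
  sumVecs : (n m : ℕ) → ((Fin n → Fin m) → A) → A
  sumVecs zero m f = f (λ ())
  sumVecs (suc n) m f = sumR m (λ k → sumVecs n m (λ v → f (consF k v)))

  -- unnormalised Gauss sum  Σ_{v ∈ L/|β|L} e((α/β) Q(w+v)), i.e. |β|^{n/2} 𝔊(α/β;w)
  gaussSum : {n : ℕ} → Character → Gram n → ℤ → ℤ → (Fin n → ℚ) → A
  gaussSum {n} ch G α β w =
    sumVecs n (ℤ.∣ β ∣) (λ v → Character.χ ch
      (frac α β ℚ.* Qf G (addV w (λ i → ι (+ toℕ (v i))))))

{-# OPTIONS --safe #-}
-- Put s = ad, t = bc and u = s·w. As s − t = 1 and t·w ∈ L, each w + v equals u + (v − t·w)
-- with v − t·w ∈ L, so the Gauss sum at w is the sum of F(y) = e((b/d) Q(u + y)) over the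
-- representatives of L/|d|L shifted by −t·w. Because (b/d)·|d| ∈ ℤ, u ∈ L♯ and Q(L) ⊆ ℤ, F is
-- |d|L-periodic and the shift can be undone. Finally (b/d) Q(u + y) = a²bd Q(w) + ab B(w, y) + (b/d) Q(y)
-- with ab B(w, y) ∈ ℤ, which pulls e(a²bd Q(w)) out of the sum.
module Submission where

open import Defs
open import Level using (Level; 0ℓ)
open import Data.Nat using (ℕ; _≥_)
open import Data.Fin using (Fin)
open import Data.Integer using (ℤ; _*_; _-_; +_)
open import Data.Rational using (ℚ) renaming (_*_ to _*ℚ_)
open import Relation.Binary.PropositionalEquality using (_≡_; _≢_)
open import Algebra.Bundles using (CommutativeRing)

import Algebra.Properties.Ring as RingProperties
import Algebra.Properties.Semiring.Sum as SemiringSum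
open import Data.Empty using (⊥-elim)
open import Data.Fin using (zero; suc; toℕ; inject₁; fromℕ)
import Data.Fin.Properties as FinP
open import Data.Integer using (_+_; -_; -[1+_]; ∣_∣)
import Data.Integer.Properties as ℤP
import Data.Integer.Tactic.RingSolver as ℤ-Solver
open import Data.Nat using (zero; suc)
import Data.Nat.Properties as ℕP
open import Data.Product using (_,_; ∃-syntax; proj₁; proj₂)
open import Data.Rational using (0ℚ; 1ℚ; ½; toℚᵘ; fromℚᵘ) renaming (_+_ to _+ℚ_; -_ to -ℚ_)
import Data.Rational.Properties as ℚP
open import Data.Rational.Unnormalised as ℚᵘ using (mkℚᵘ; *≡*)
import Data.Rational.Unnormalised.Properties as ℚᵘP
open import Data.Vec.Functional using (_∷_; zipWith)
open import Function using (_∘_)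
open import Relation.Binary.Bundles using (Setoid)
open import Relation.Binary.PropositionalEquality using (_≗_; refl; sym; trans; cong; cong₂; subst; module ≡-Reasoning)
open import Relation.Nullary.Decidable using (dec⇒maybe)
open import Tactic.RingSolver using (solve-∀)
open import Tactic.RingSolver.Core.AlmostCommutativeRing using (AlmostCommutativeRing; fromCommutativeRing)

ℚ-ring : AlmostCommutativeRing 0ℓ 0ℓ
ℚ-ring = fromCommutativeRing ℚP.+-*-commutativeRing (λ x → dec⇒maybe (0ℚ ℚP.≟ x))

module ℚ-RingProperties = RingProperties (CommutativeRing.ring ℚP.+-*-commutativeRing)

fromℚᵘ-homo-+ : ∀ p q → fromℚᵘ (p ℚᵘ.+ q) ≡ fromℚᵘ p +ℚ fromℚᵘ q
fromℚᵘ-homo-+ p q = ℚP.toℚᵘ-injective (begin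
  toℚᵘ (fromℚᵘ (p ℚᵘ.+ q))                   ≈⟨ ℚP.toℚᵘ-fromℚᵘ (p ℚᵘ.+ q) ⟩
  p ℚᵘ.+ q                                   ≈⟨ ℚᵘP.+-cong (ℚP.toℚᵘ-fromℚᵘ p) (ℚP.toℚᵘ-fromℚᵘ q) ⟨
  toℚᵘ (fromℚᵘ p) ℚᵘ.+ toℚᵘ (fromℚᵘ q)       ≈⟨ ℚP.toℚᵘ-homo-+ (fromℚᵘ p) (fromℚᵘ q) ⟨
  toℚᵘ (fromℚᵘ p +ℚ fromℚᵘ q)                ∎)
  where open ℚᵘP.≃-Reasoning

fromℚᵘ-homo-* : ∀ p q → fromℚᵘ (p ℚᵘ.* q) ≡ fromℚᵘ p *ℚ fromℚᵘ q
fromℚᵘ-homo-* p q = ℚP.toℚᵘ-injective (begin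
  toℚᵘ (fromℚᵘ (p ℚᵘ.* q))                   ≈⟨ ℚP.toℚᵘ-fromℚᵘ (p ℚᵘ.* q) ⟩
  p ℚᵘ.* q                                   ≈⟨ ℚᵘP.*-cong (ℚP.toℚᵘ-fromℚᵘ p) (ℚP.toℚᵘ-fromℚᵘ q) ⟨
  toℚᵘ (fromℚᵘ p) ℚᵘ.* toℚᵘ (fromℚᵘ q)       ≈⟨ ℚP.toℚᵘ-homo-* (fromℚᵘ p) (fromℚᵘ q) ⟨
  toℚᵘ (fromℚᵘ p *ℚ fromℚᵘ q)                ∎)
  where open ℚᵘP.≃-Reasoning

fromℚᵘ-homo‿- : ∀ p → fromℚᵘ (ℚᵘ.- p) ≡ -ℚ fromℚᵘ p
fromℚᵘ-homo‿- p = ℚP.toℚᵘ-injective (begin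
  toℚᵘ (fromℚᵘ (ℚᵘ.- p))                     ≈⟨ ℚP.toℚᵘ-fromℚᵘ (ℚᵘ.- p) ⟩
  ℚᵘ.- p                                     ≈⟨ ℚᵘP.-‿cong (ℚP.toℚᵘ-fromℚᵘ p) ⟨
  ℚᵘ.- toℚᵘ (fromℚᵘ p)                       ≈⟨ ℚP.toℚᵘ-homo‿- (fromℚᵘ p) ⟨
  toℚᵘ (-ℚ fromℚᵘ p)                         ∎)
  where open ℚᵘP.≃-Reasoning

ι-homo-+ : ∀ x y → ι (x + y) ≡ ι x +ℚ ι y
ι-homo-+ x y = trans (ℚP.fromℚᵘ-cong sum≃) (fromℚᵘ-homo-+ (mkℚᵘ x 0) (mkℚᵘ y 0))
  where
  sum≃ : mkℚᵘ (x + y) 0 ℚᵘ.≃ mkℚᵘ x 0 ℚᵘ.+ mkℚᵘ y 0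
  sum≃ = *≡* (cong (_* + 1) (sym (cong₂ _+_ (ℤP.*-identityʳ x) (ℤP.*-identityʳ y))))

ι-homo-* : ∀ x y → ι (x * y) ≡ ι x *ℚ ι y
ι-homo-* x y = fromℚᵘ-homo-* (mkℚᵘ x 0) (mkℚᵘ y 0)

ι-homo‿- : ∀ x → ι (- x) ≡ -ℚ ι x
ι-homo‿- x = fromℚᵘ-homo‿- (mkℚᵘ x 0)

IsInt-+ : ∀ {p q} → IsInt p → IsInt q → IsInt (p +ℚ q)
IsInt-+ (x , refl) (y , refl) = x + y , sym (ι-homo-+ x y)

IsInt-* : ∀ {p q} → IsInt p → IsInt q → IsInt (p *ℚ q)
IsInt-* (x , refl) (y , refl) = x * y , sym (ι-homo-* x y)

IsInt-neg : ∀ {p} → IsInt p → IsInt (-ℚ p)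
IsInt-neg (x , refl) = - x , sym (ι-homo‿- x)

fromℚᵘ-*-denominator : ∀ x k → fromℚᵘ (mkℚᵘ x k) *ℚ ι (+ suc k) ≡ ι x
fromℚᵘ-*-denominator x k = trans (sym (fromℚᵘ-homo-* (mkℚᵘ x k) (mkℚᵘ (+ suc k) 0))) (ℚP.fromℚᵘ-cong cancel)
  where
  cancel : mkℚᵘ x k ℚᵘ.* mkℚᵘ (+ suc k) 0 ℚᵘ.≃ mkℚᵘ x 0
  cancel = *≡* (trans (ℤP.*-identityʳ _) (cong (x *_) (sym (ℤP.*-identityʳ (+ suc k)))))

frac-*-ι : ∀ α β → β ≢ + 0 → frac α β *ℚ ι β ≡ ι α
frac-*-ι α (+ zero)  β≢0 = ⊥-elim (β≢0 refl)
frac-*-ι α (+ suc k) _   = fromℚᵘ-*-denominator α k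
frac-*-ι α -[1+ k ]  _   = begin
  fromℚᵘ (mkℚᵘ (- α) k) *ℚ (-ℚ ι (+ suc k))  ≡⟨ ℚP.neg-distribʳ-* (fromℚᵘ (mkℚᵘ (- α) k)) (ι (+ suc k)) ⟨
  -ℚ (fromℚᵘ (mkℚᵘ (- α) k) *ℚ ι (+ suc k))  ≡⟨ cong -ℚ_ (fromℚᵘ-*-denominator (- α) k) ⟩
  -ℚ ι (- α)                                 ≡⟨ cong -ℚ_ (ι-homo‿- α) ⟩
  -ℚ (-ℚ ι α)                                ≡⟨ ℚ-RingProperties.-‿involutive (ι α) ⟩
  ι α                                        ∎
  where open ≡-Reasoning

frac-*-ι-multiple : ∀ a α β → β ≢ + 0 → frac α β *ℚ ι (a * β) ≡ ι (a * α)
frac-*-ι-multiple a α β β≢0 = begin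
  frac α β *ℚ ι (a * β)       ≡⟨ cong (frac α β *ℚ_) (ι-homo-* a β) ⟩
  frac α β *ℚ (ι a *ℚ ι β)    ≡⟨ swap (frac α β) (ι a) (ι β) ⟩
  ι a *ℚ (frac α β *ℚ ι β)    ≡⟨ cong (ι a *ℚ_) (frac-*-ι α β β≢0) ⟩
  ι a *ℚ ι α                  ≡⟨ ι-homo-* a α ⟨
  ι (a * α)                   ∎
  where
  open ≡-Reasoning
  swap : ∀ p q r → p *ℚ (q *ℚ r) ≡ q *ℚ (p *ℚ r)
  swap = solve-∀ ℚ-ring

frac-*-ι-multiple² : ∀ a α β → β ≢ + 0 → (frac α β *ℚ ι (a * β)) *ℚ ι (a * β) ≡ ι (a * a * α * β)
frac-*-ι-multiple² a α β β≢0 = begin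
  (frac α β *ℚ ι (a * β)) *ℚ ι (a * β)  ≡⟨ cong (_*ℚ ι (a * β)) (frac-*-ι-multiple a α β β≢0) ⟩
  ι (a * α) *ℚ ι (a * β)                ≡⟨ ι-homo-* (a * α) (a * β) ⟨
  ι ((a * α) * (a * β))                 ≡⟨ cong ι (reorder a α β) ⟩
  ι (a * a * α * β)                     ∎
  where
  open ≡-Reasoning
  reorder : ∀ a α β → (a * α) * (a * β) ≡ a * a * α * β
  reorder = ℤ-Solver.solve-∀

frac-*-ι∣∣-IsInt : ∀ α β → β ≢ + 0 → IsInt (frac α β *ℚ ι (+ ∣ β ∣))
frac-*-ι∣∣-IsInt α (+ zero)  β≢0 = ⊥-elim (β≢0 refl)
frac-*-ι∣∣-IsInt α (+ suc k) _   = α , fromℚᵘ-*-denominator α k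
frac-*-ι∣∣-IsInt α -[1+ k ]  _   = - α , fromℚᵘ-*-denominator (- α) k

module ℚ-Sum = SemiringSum (CommutativeRing.semiring ℚP.+-*-commutativeRing)
open ℚ-Sum using (sum; sum-cong-≗; ∑-distrib-+; ∑-comm; *-distribˡ-sum)

sumℚ≡sum : ∀ n (f : Fin n → ℚ) → sumℚ n f ≡ sum f
sumℚ≡sum zero    f = refl
sumℚ≡sum (suc n) f = cong (f zero +ℚ_) (sumℚ≡sum n (f ∘ suc))

∑∑ : ∀ {n} → (Fin n → Fin n → ℚ) → ℚ
∑∑ f = sum (λ i → sum (f i))

∑∑-cong : ∀ {n} {f g : Fin n → Fin n → ℚ} → (∀ i j → f i j ≡ g i j) → ∑∑ f ≡ ∑∑ g
∑∑-cong f≡g = sum-cong-≗ (λ i → sum-cong-≗ (f≡g i))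

∑∑-distrib-+ : ∀ {n} (f g : Fin n → Fin n → ℚ) → ∑∑ (λ i j → f i j +ℚ g i j) ≡ ∑∑ f +ℚ ∑∑ g
∑∑-distrib-+ f g =
  trans (sum-cong-≗ (λ i → ∑-distrib-+ (f i) (g i))) (∑-distrib-+ (λ i → sum (f i)) (λ i → sum (g i)))

*-distribˡ-∑∑ : ∀ {n} q (f : Fin n → Fin n → ℚ) → ∑∑ (λ i j → q *ℚ f i j) ≡ q *ℚ ∑∑ f
*-distribˡ-∑∑ q f =
  sym (trans (*-distribˡ-sum q (λ i → sum (f i))) (sum-cong-≗ (λ i → *-distribˡ-sum q (f i))))

module _ {n : ℕ} (G : Gram n) where

  Bf-term : (Fin n → ℚ) → (Fin n → ℚ) → Fin n → Fin n → ℚ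
  Bf-term x y i j = x i *ℚ (G i j *ℚ y j)

  Bf≡∑∑ : ∀ x y → Bf G x y ≡ ∑∑ (Bf-term x y)
  Bf≡∑∑ x y = trans (sumℚ≡sum n (λ i → sumℚ n (Bf-term x y i))) (sum-cong-≗ (λ i → sumℚ≡sum n (Bf-term x y i)))

  Bf-cong : ∀ {x x' y y'} → x ≗ x' → y ≗ y' → Bf G x y ≡ Bf G x' y'
  Bf-cong {x} {x'} {y} {y'} x≗x' y≗y' = begin
    Bf G x y             ≡⟨ Bf≡∑∑ x y ⟩
    ∑∑ (Bf-term x y)     ≡⟨ ∑∑-cong (λ i j → cong₂ (λ p q → p *ℚ (G i j *ℚ q)) (x≗x' i) (y≗y' j)) ⟩
    ∑∑ (Bf-term x' y')   ≡⟨ Bf≡∑∑ x' y' ⟨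
    Bf G x' y'           ∎
    where open ≡-Reasoning

  Bf-+-termwise : ∀ x y x₁ y₁ x₂ y₂ → (∀ i j → Bf-term x y i j ≡ Bf-term x₁ y₁ i j +ℚ Bf-term x₂ y₂ i j) →
                  Bf G x y ≡ Bf G x₁ y₁ +ℚ Bf G x₂ y₂
  Bf-+-termwise x y x₁ y₁ x₂ y₂ split = begin
    Bf G x y                                              ≡⟨ Bf≡∑∑ x y ⟩
    ∑∑ (Bf-term x y)                                      ≡⟨ ∑∑-cong split ⟩
    ∑∑ (λ i j → Bf-term x₁ y₁ i j +ℚ Bf-term x₂ y₂ i j)   ≡⟨ ∑∑-distrib-+ (Bf-term x₁ y₁) (Bf-term x₂ y₂) ⟩
    ∑∑ (Bf-term x₁ y₁) +ℚ ∑∑ (Bf-term x₂ y₂)              ≡⟨ cong₂ _+ℚ_ (Bf≡∑∑ x₁ y₁) (Bf≡∑∑ x₂ y₂) ⟨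
    Bf G x₁ y₁ +ℚ Bf G x₂ y₂                              ∎
    where open ≡-Reasoning

  Bf-*-termwise : ∀ q x y x₁ y₁ → (∀ i j → Bf-term x y i j ≡ q *ℚ Bf-term x₁ y₁ i j) →
                  Bf G x y ≡ q *ℚ Bf G x₁ y₁
  Bf-*-termwise q x y x₁ y₁ factor = begin
    Bf G x y                               ≡⟨ Bf≡∑∑ x y ⟩
    ∑∑ (Bf-term x y)                       ≡⟨ ∑∑-cong factor ⟩
    ∑∑ (λ i j → q *ℚ Bf-term x₁ y₁ i j)    ≡⟨ *-distribˡ-∑∑ q (Bf-term x₁ y₁) ⟩
    q *ℚ ∑∑ (Bf-term x₁ y₁)                ≡⟨ cong (q *ℚ_) (Bf≡∑∑ x₁ y₁) ⟨
    q *ℚ Bf G x₁ y₁                        ∎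
    where open ≡-Reasoning

  Bf-addˡ : ∀ x y z → Bf G (addV x y) z ≡ Bf G x z +ℚ Bf G y z
  Bf-addˡ x y z = Bf-+-termwise (addV x y) z x z y z (λ i j → distrib (x i) (y i) (G i j) (z j))
    where
    distrib : ∀ x y g z → (x +ℚ y) *ℚ (g *ℚ z) ≡ x *ℚ (g *ℚ z) +ℚ y *ℚ (g *ℚ z)
    distrib = solve-∀ ℚ-ring

  Bf-addʳ : ∀ x y z → Bf G z (addV x y) ≡ Bf G z x +ℚ Bf G z y
  Bf-addʳ x y z = Bf-+-termwise z (addV x y) z x z y (λ i j → distrib (x j) (y j) (G i j) (z i))
    where
    distrib : ∀ x y g z → z *ℚ (g *ℚ (x +ℚ y)) ≡ z *ℚ (g *ℚ x) +ℚ z *ℚ (g *ℚ y)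
    distrib = solve-∀ ℚ-ring

  Bf-scaleˡ : ∀ q x y → Bf G (scaleV q x) y ≡ q *ℚ Bf G x y
  Bf-scaleˡ q x y = Bf-*-termwise q (scaleV q x) y x y (λ i j → assoc q (x i) (G i j) (y j))
    where
    assoc : ∀ q x g y → (q *ℚ x) *ℚ (g *ℚ y) ≡ q *ℚ (x *ℚ (g *ℚ y))
    assoc = solve-∀ ℚ-ring

  Bf-scaleʳ : ∀ q x y → Bf G y (scaleV q x) ≡ q *ℚ Bf G y x
  Bf-scaleʳ q x y = Bf-*-termwise q y (scaleV q x) y x (λ i j → pull q (x j) (G i j) (y i))
    where
    pull : ∀ q x g y → y *ℚ (g *ℚ (q *ℚ x)) ≡ q *ℚ (y *ℚ (g *ℚ x))
    pull = solve-∀ ℚ-ring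

  Bf-sym : Symmetric G → ∀ x y → Bf G x y ≡ Bf G y x
  Bf-sym G-sym x y = begin
    Bf G x y                                  ≡⟨ Bf≡∑∑ x y ⟩
    ∑∑ (Bf-term x y)                          ≡⟨ ∑-comm (Bf-term x y) ⟩
    sum (λ j → sum (λ i → Bf-term x y i j))   ≡⟨ ∑∑-cong (λ j i → transpose (x i) (y j) (G-sym i j)) ⟩
    ∑∑ (Bf-term y x)                          ≡⟨ Bf≡∑∑ y x ⟨
    Bf G y x                                  ∎
    where
    open ≡-Reasoning
    swap : ∀ x g y → x *ℚ (g *ℚ y) ≡ y *ℚ (g *ℚ x)
    swap = solve-∀ ℚ-ring
    transpose : ∀ x y {g g'} → g ≡ g' → x *ℚ (g *ℚ y) ≡ y *ℚ (g' *ℚ x)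
    transpose x y {g} refl = swap x g y

  Qf-cong : ∀ {x x'} → x ≗ x' → Qf G x ≡ Qf G x'
  Qf-cong x≗x' = cong (½ *ℚ_) (Bf-cong x≗x' x≗x')

  Qf-scale : ∀ q x → Qf G (scaleV q x) ≡ (q *ℚ q) *ℚ Qf G x
  Qf-scale q x = begin
    ½ *ℚ Bf G (scaleV q x) (scaleV q x)  ≡⟨ cong (½ *ℚ_) (trans (Bf-scaleˡ q x _) (cong (q *ℚ_) (Bf-scaleʳ q x x))) ⟩
    ½ *ℚ (q *ℚ (q *ℚ Bf G x x))          ≡⟨ reassoc ½ q (Bf G x x) ⟩
    (q *ℚ q) *ℚ Qf G x                   ∎
    where
    open ≡-Reasoning
    reassoc : ∀ h q b → h *ℚ (q *ℚ (q *ℚ b)) ≡ (q *ℚ q) *ℚ (h *ℚ b)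
    reassoc = solve-∀ ℚ-ring

  Qf-add : Symmetric G → ∀ x y → Qf G (addV x y) ≡ (Qf G x +ℚ Bf G x y) +ℚ Qf G y
  Qf-add G-sym x y = begin
    ½ *ℚ Bf G (addV x y) (addV x y)                          ≡⟨ cong (½ *ℚ_) expand ⟩
    ½ *ℚ ((Bf G x x +ℚ Bf G x y) +ℚ (Bf G x y +ℚ Bf G y y))  ≡⟨ halve ½ (Bf G x x) (Bf G x y) (Bf G y y) ⟩
    (Qf G x +ℚ (½ +ℚ ½) *ℚ Bf G x y) +ℚ Qf G y               ≡⟨ cong (λ t → (Qf G x +ℚ t) +ℚ Qf G y)
                                                                     (ℚP.*-identityˡ (Bf G x y)) ⟩
    (Qf G x +ℚ Bf G x y) +ℚ Qf G y                           ∎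
    where
    open ≡-Reasoning
    expand : Bf G (addV x y) (addV x y) ≡ (Bf G x x +ℚ Bf G x y) +ℚ (Bf G x y +ℚ Bf G y y)
    expand = trans (Bf-addˡ x y (addV x y)) (cong₂ _+ℚ_ (Bf-addʳ x y x)
               (trans (Bf-addʳ x y y) (cong (_+ℚ Bf G y y) (Bf-sym G-sym y x))))
    halve : ∀ h a b c → h *ℚ ((a +ℚ b) +ℚ (b +ℚ c)) ≡ (h *ℚ a +ℚ (h +ℚ h) *ℚ b) +ℚ h *ℚ c
    halve = solve-∀ ℚ-ring

  Qf-scaled-add : Symmetric G → ∀ β s w x →
                  β *ℚ Qf G (addV (scaleV s w) x) ≡
                  ((β *ℚ s) *ℚ s) *ℚ Qf G w +ℚ ((β *ℚ s) *ℚ Bf G w x +ℚ β *ℚ Qf G x)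
  Qf-scaled-add G-sym β s w x = begin
    β *ℚ Qf G (addV (scaleV s w) x)                               ≡⟨ cong (β *ℚ_) (Qf-add G-sym (scaleV s w) x) ⟩
    β *ℚ ((Qf G (scaleV s w) +ℚ Bf G (scaleV s w) x) +ℚ Qf G x)  ≡⟨ cong (λ q → β *ℚ (q +ℚ Qf G x))
                                                                       (cong₂ _+ℚ_ (Qf-scale s w) (Bf-scaleˡ s w x)) ⟩
    β *ℚ (((s *ℚ s) *ℚ Qf G w +ℚ s *ℚ Bf G w x) +ℚ Qf G x)       ≡⟨ distribute β s (Qf G w) (Bf G w x) (Qf G x) ⟩
    ((β *ℚ s) *ℚ s) *ℚ Qf G w +ℚ ((β *ℚ s) *ℚ Bf G w x +ℚ β *ℚ Qf G x) ∎
    where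
    open ≡-Reasoning
    distribute : ∀ β s q b r → β *ℚ (((s *ℚ s) *ℚ q +ℚ s *ℚ b) +ℚ r) ≡
                               ((β *ℚ s) *ℚ s) *ℚ q +ℚ ((β *ℚ s) *ℚ b +ℚ β *ℚ r)
    distribute = solve-∀ ℚ-ring

  InDual-embed : Symmetric G → EvenIntegral G → ∀ y → InDual G (embed y)
  InDual-embed G-sym G-even y k = subst IsInt (sym polarization)
    (IsInt-+ (IsInt-+ (G-even (λ i → y i + k i)) (IsInt-neg (G-even y))) (IsInt-neg (G-even k)))
    where
    Qy Qk Byk : ℚ
    Qy = Qf G (embed y)
    Qk = Qf G (embed k)
    Byk = Bf G (embed y) (embed k)
    expand : Qf G (embed (λ i → y i + k i)) ≡ (Qy +ℚ Byk) +ℚ Qk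
    expand = trans (Qf-cong (λ i → ι-homo-+ (y i) (k i))) (Qf-add G-sym (embed y) (embed k))
    isolate : ∀ a b c → b ≡ (((a +ℚ b) +ℚ c) +ℚ -ℚ a) +ℚ -ℚ c
    isolate = solve-∀ ℚ-ring
    polarization : Byk ≡ (Qf G (embed (λ i → y i + k i)) +ℚ -ℚ Qy) +ℚ -ℚ Qk
    polarization = trans (isolate Qy Byk Qk) (cong (λ q → (q +ℚ -ℚ Qy) +ℚ -ℚ Qk) (sym expand))

  InDual-add : ∀ u u' → InDual G u → InDual G u' → InDual G (addV u u')
  InDual-add u u' u∈L♯ u'∈L♯ k = subst IsInt (sym (Bf-addˡ u u' (embed k))) (IsInt-+ (u∈L♯ k) (u'∈L♯ k))

  InDual-scale : ∀ z u → InDual G u → InDual G (scaleV (ι z) u)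
  InDual-scale z u u∈L♯ k = subst IsInt (sym (Bf-scaleˡ (ι z) u (embed k))) (IsInt-* (z , refl) (u∈L♯ k))

recentre : ∀ {n} s t (w : Fin n → ℚ) (z : Fin n → ℤ) → s - t ≡ + 1 → (∀ i → ι t *ℚ w i ≡ ι (z i)) →
           ∀ y → addV w (embed y) ≗ addV (scaleV (ι s) w) (embed (λ i → y i - z i))
recentre s t w z s-t≡1 tw≡z y i = begin
  w i +ℚ ι (y i)                               ≡⟨ cong (_+ℚ ι (y i)) (ℚP.*-identityˡ (w i)) ⟨
  1ℚ *ℚ w i +ℚ ι (y i)                         ≡⟨ cong (λ q → q *ℚ w i +ℚ ι (y i)) ιs-ιt≡1 ⟨
  (ι s +ℚ -ℚ ι t) *ℚ w i +ℚ ι (y i)            ≡⟨ regroup (ι s) (ι t) (w i) (ι (y i)) ⟩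
  ι s *ℚ w i +ℚ (ι (y i) +ℚ -ℚ (ι t *ℚ w i))   ≡⟨ cong (λ q → ι s *ℚ w i +ℚ (ι (y i) +ℚ -ℚ q)) (tw≡z i) ⟩
  ι s *ℚ w i +ℚ (ι (y i) +ℚ -ℚ ι (z i))        ≡⟨ cong (ι s *ℚ w i +ℚ_) (ι-difference (y i) (z i)) ⟨
  ι s *ℚ w i +ℚ ι (y i - z i)                  ∎
  where
  open ≡-Reasoning
  ι-difference : ∀ x y → ι (x - y) ≡ ι x +ℚ -ℚ ι y
  ι-difference x y = trans (ι-homo-+ x (- y)) (cong (ι x +ℚ_) (ι-homo‿- y))
  ιs-ιt≡1 : ι s +ℚ -ℚ ι t ≡ 1ℚ
  ιs-ιt≡1 = trans (sym (ι-difference s t)) (cong ι s-t≡1)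
  regroup : ∀ s t w y → (s +ℚ -ℚ t) *ℚ w +ℚ y ≡ s *ℚ w +ℚ (y +ℚ -ℚ (t *ℚ w))
  regroup = solve-∀ ℚ-ring

module _ {a ℓ : Level} (S : Setoid a ℓ) where
  open Setoid S using (Carrier; _≈_) renaming (refl to ≈-refl; sym to ≈-sym; trans to ≈-trans; reflexive to ≈-reflexive)

  suc-invariant⇒constant : ∀ (f : ℤ → Carrier) → (∀ t → f (t + + 1) ≈ f t) → ∀ t → f t ≈ f (+ 0)
  suc-invariant⇒constant f inv (+ zero)     = ≈-refl
  suc-invariant⇒constant f inv (+ suc n)    =
    ≈-trans (≈-reflexive (cong (f ∘ +_) (ℕP.+-comm 1 n))) (≈-trans (inv (+ n)) (suc-invariant⇒constant f inv (+ n)))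
  suc-invariant⇒constant f inv -[1+ zero ]  = ≈-sym (inv -[1+ zero ])
  suc-invariant⇒constant f inv -[1+ suc n ] =
    ≈-trans (≈-sym (inv -[1+ suc n ])) (suc-invariant⇒constant f inv -[1+ n ])

toℤⁿ : ∀ {n m} → (Fin n → Fin m) → Fin n → ℤ
toℤⁿ v i = + toℕ (v i)

module _ {c ℓ : Level} (R : CommutativeRing c ℓ) where
  open CommutativeRing R using (_≈_; setoid; +-cong; +-comm)
    renaming ( Carrier to A; _+_ to _+ᴿ_; _*_ to _*ᴿ_
             ; refl to ≈-refl; sym to ≈-sym; trans to ≈-trans; reflexive to ≈-reflexive)
  open import Relation.Binary.Reasoning.Setoid setoid
  module R-Sum = SemiringSum (CommutativeRing.semiring R)

  sumR≡sum : ∀ m (f : Fin m → A) → sumR R m f ≡ R-Sum.sum f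
  sumR≡sum zero    f = refl
  sumR≡sum (suc m) f = cong (f zero +ᴿ_) (sumR≡sum m (f ∘ suc))

  sumR-cong : ∀ m {f g : Fin m → A} → (∀ i → f i ≈ g i) → sumR R m f ≈ sumR R m g
  sumR-cong m {f} {g} f≈g = begin
    sumR R m f    ≡⟨ sumR≡sum m f ⟩
    R-Sum.sum f   ≈⟨ R-Sum.sum-cong-≋ f≈g ⟩
    R-Sum.sum g   ≡⟨ sumR≡sum m g ⟨
    sumR R m g    ∎

  *-distribˡ-sumR : ∀ m x (f : Fin m → A) → x *ᴿ sumR R m f ≈ sumR R m (λ i → x *ᴿ f i)
  *-distribˡ-sumR m x f = begin
    x *ᴿ sumR R m f              ≡⟨ cong (x *ᴿ_) (sumR≡sum m f) ⟩
    x *ᴿ R-Sum.sum f             ≈⟨ R-Sum.*-distribˡ-sum x f ⟩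
    R-Sum.sum (λ i → x *ᴿ f i)   ≡⟨ sumR≡sum m (λ i → x *ᴿ f i) ⟨
    sumR R m (λ i → x *ᴿ f i)    ∎

  sumR-init-last : ∀ m (f : Fin (suc m) → A) → sumR R (suc m) f ≈ sumR R m (f ∘ inject₁) +ᴿ f (fromℕ m)
  sumR-init-last m f = begin
    sumR R (suc m) f                          ≡⟨ sumR≡sum (suc m) f ⟩
    R-Sum.sum f                               ≈⟨ R-Sum.sum-init-last f ⟩
    R-Sum.sum (f ∘ inject₁) +ᴿ f (fromℕ m)    ≡⟨ cong (_+ᴿ f (fromℕ m)) (sumR≡sum m (f ∘ inject₁)) ⟨
    sumR R m (f ∘ inject₁) +ᴿ f (fromℕ m)     ∎

  sumVecs-cong : ∀ n m {f g : (Fin n → Fin m) → A} → (∀ v → f v ≈ g v) → sumVecs R n m f ≈ sumVecs R n m g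
  sumVecs-cong zero    m f≈g = f≈g _
  sumVecs-cong (suc n) m f≈g = sumR-cong m (λ k → sumVecs-cong n m (λ v → f≈g _))

  *-distribˡ-sumVecs : ∀ n m x (f : (Fin n → Fin m) → A) → x *ᴿ sumVecs R n m f ≈ sumVecs R n m (λ v → x *ᴿ f v)
  *-distribˡ-sumVecs zero    m x f = ≈-refl
  *-distribˡ-sumVecs (suc n) m x f =
    ≈-trans (*-distribˡ-sumR m x _) (sumR-cong m (λ k → *-distribˡ-sumVecs n m x _))

  Periodic : ∀ {n} → ℕ → ((Fin n → ℤ) → A) → Set ℓ
  Periodic m F = ∀ y y' → (∀ i → ∃[ k ] y' i ≡ y i + k * + m) → F y ≈ F y'

  Periodic-≗ : ∀ {n m} {F : (Fin n → ℤ) → A} → Periodic m F → ∀ {y y'} → y ≗ y' → F y ≈ F y'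
  Periodic-≗ F-per {y} {y'} y≗y' = F-per y y' (λ i → + 0 , trans (sym (y≗y' i)) (sym (ℤP.+-identityʳ (y i))))

  Periodic-∷ : ∀ {n m} {F : (Fin (suc n) → ℤ) → A} → Periodic m F → ∀ z → Periodic m (λ u → F (z ∷ u))
  Periodic-∷ F-per z u u' u'≡u+mk = F-per (z ∷ u) (z ∷ u') λ where
    zero    → + 0 , sym (ℤP.+-identityʳ z)
    (suc i) → u'≡u+mk i

  -- Shifting by one rotates the summands: the last one, h (m + t), equals the new first one, h t.
  sumR-shift-suc : ∀ m (h : ℤ → A) → (∀ z → h (z + + m) ≈ h z) →
                   ∀ t → sumR R m (λ k → h (+ toℕ k + (t + + 1))) ≈ sumR R m (λ k → h (+ toℕ k + t))
  sumR-shift-suc zero    h h-per t = ≈-refl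
  sumR-shift-suc (suc m) h h-per t = begin
    sumR R (suc m) (λ k → h (+ toℕ k + (t + + 1)))
      ≈⟨ sumR-init-last m (λ k → h (+ toℕ k + (t + + 1))) ⟩
    sumR R m (λ k → h (+ toℕ (inject₁ k) + (t + + 1))) +ᴿ h (+ toℕ (fromℕ m) + (t + + 1))
      ≈⟨ +-cong (sumR-cong m (λ k → ≈-reflexive (cong h (reindex k)))) wrap ⟩
    sumR R m (λ k → h (+ toℕ (suc k) + t)) +ᴿ h (+ 0 + t)
      ≈⟨ +-comm _ _ ⟩
    sumR R (suc m) (λ k → h (+ toℕ k + t))
      ∎
    where
    shuffle₁ : ∀ j t → j + (t + + 1) ≡ (+ 1 + j) + t
    shuffle₁ = ℤ-Solver.solve-∀
    shuffle₂ : ∀ j t → j + (t + + 1) ≡ t + (+ 1 + j)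
    shuffle₂ = ℤ-Solver.solve-∀
    reindex : ∀ k → + toℕ (inject₁ k) + (t + + 1) ≡ + toℕ (suc k) + t
    reindex k = trans (cong (λ j → + j + (t + + 1)) (FinP.toℕ-inject₁ k)) (shuffle₁ (+ toℕ k) t)
    wrap : h (+ toℕ (fromℕ m) + (t + + 1)) ≈ h (+ 0 + t)
    wrap = begin
      h (+ toℕ (fromℕ m) + (t + + 1))  ≡⟨ cong (λ j → h (+ j + (t + + 1))) (FinP.toℕ-fromℕ m) ⟩
      h (+ m + (t + + 1))              ≡⟨ cong h (shuffle₂ (+ m) t) ⟩
      h (t + + suc m)                  ≈⟨ h-per t ⟩
      h t                              ≡⟨ cong h (ℤP.+-identityˡ t) ⟨
      h (+ 0 + t)                      ∎

  sumR-shift : ∀ m (h : ℤ → A) → (∀ z → h (z + + m) ≈ h z) →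
               ∀ t → sumR R m (λ k → h (+ toℕ k + t)) ≈ sumR R m (λ k → h (+ toℕ k))
  sumR-shift m h h-per t = begin
    sumR R m (λ k → h (+ toℕ k + t))
      ≈⟨ suc-invariant⇒constant setoid (λ t → sumR R m (λ k → h (+ toℕ k + t))) (sumR-shift-suc m h h-per) t ⟩
    sumR R m (λ k → h (+ toℕ k + + 0))
      ≈⟨ sumR-cong m (λ k → ≈-reflexive (cong h (ℤP.+-identityʳ (+ toℕ k)))) ⟩
    sumR R m (λ k → h (+ toℕ k))
      ∎

  sumVecs-shift : ∀ n m (F : (Fin n → ℤ) → A) → Periodic m F →
                  ∀ t → sumVecs R n m (λ v → F (zipWith _+_ (toℤⁿ v) t)) ≈ sumVecs R n m (λ v → F (toℤⁿ v))
  sumVecs-shift zero    m F F-per t = Periodic-≗ F-per (λ ())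
  sumVecs-shift (suc n) m F F-per t = begin
    sumR R m (λ k → sumVecs R n m (λ v → F (zipWith _+_ (toℤⁿ (consF R k v)) t)))
      ≈⟨ sumR-cong m (λ k → sumVecs-cong n m (λ v → Periodic-≗ F-per (λ { zero → refl ; (suc i) → refl }))) ⟩
    sumR R m (λ k → sumVecs R n m (λ v → F ((+ toℕ k + t zero) ∷ zipWith _+_ (toℤⁿ v) (t ∘ suc))))
      ≈⟨ sumR-cong m (λ k → sumVecs-shift n m _ (Periodic-∷ F-per (+ toℕ k + t zero)) (t ∘ suc)) ⟩
    sumR R m (λ k → H (+ toℕ k + t zero))
      ≈⟨ sumR-shift m H H-per (t zero) ⟩
    sumR R m (λ k → H (+ toℕ k))
      ≈⟨ sumR-cong m (λ k → sumVecs-cong n m (λ v → Periodic-≗ F-per (λ { zero → refl ; (suc i) → refl }))) ⟩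
    sumR R m (λ k → sumVecs R n m (λ v → F (toℤⁿ (consF R k v))))
      ∎
    where
    H : ℤ → A
    H z = sumVecs R n m (λ v → F (z ∷ toℤⁿ v))
    H-per : ∀ z → H (z + + m) ≈ H z
    H-per z = sumVecs-cong n m (λ v → ≈-sym (F-per (z ∷ toℤⁿ v) ((z + + m) ∷ toℤⁿ v) λ where
      zero    → + 1 , cong (λ j → z + j) (sym (ℤP.*-identityˡ (+ m)))
      (suc i) → + 0 , sym (ℤP.+-identityʳ _)))

module _ {c ℓ : Level} (R : CommutativeRing c ℓ) (ch : Character R) where
  open CommutativeRing R using (_≈_; 1#; *-cong; *-identityˡ)
    renaming (_*_ to _*ᴿ_; refl to ≈-refl; sym to ≈-sym; trans to ≈-trans; reflexive to ≈-reflexive)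
  open Character ch

  χ-IsInt : ∀ {p} → IsInt p → χ p ≈ 1#
  χ-IsInt (z , refl) = χ-int z

  χ-IsInt-+ : ∀ {p} q → IsInt p → χ (p +ℚ q) ≈ χ q
  χ-IsInt-+ q p∈ℤ = ≈-trans (χ-add _ q) (≈-trans (*-cong (χ-IsInt p∈ℤ) ≈-refl) (*-identityˡ (χ q)))

  χ∘Qf-periodic : ∀ {n} {G : Gram n} → Symmetric G → EvenIntegral G →
                  ∀ β m u → IsInt (β *ℚ ι (+ m)) → InDual G u →
                  Periodic R m (λ y → χ (β *ℚ Qf G (addV u (embed y))))
  χ∘Qf-periodic {G = G} G-sym G-even β m u βm∈ℤ u∈L♯ y y' y'≡y+mk = ≈-sym (begin
    χ (β *ℚ Qf G (addV u (embed y')))       ≡⟨ cong (λ q → χ (β *ℚ q)) (Qf-cong G y'-split) ⟩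
    χ (β *ℚ Qf G (addV x (scaleV M K)))     ≡⟨ cong χ expand ⟩
    χ (integral +ℚ β *ℚ Qf G x)             ≈⟨ χ-IsInt-+ (β *ℚ Qf G x) integral∈ℤ ⟩
    χ (β *ℚ Qf G x)                         ∎)
    where
    open import Relation.Binary.Reasoning.Setoid (CommutativeRing.setoid R)
    k : Fin _ → ℤ
    k i = proj₁ (y'≡y+mk i)
    x : Fin _ → ℚ
    x = addV u (embed y)
    M : ℚ
    M = ι (+ m)
    K : Fin _ → ℚ
    K = embed k
    integral : ℚ
    integral = (β *ℚ M) *ℚ Bf G x K +ℚ ((β *ℚ M) *ℚ M) *ℚ Qf G K
    regroup : ∀ u a b M → u +ℚ (a +ℚ b *ℚ M) ≡ (u +ℚ a) +ℚ M *ℚ b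
    regroup = solve-∀ ℚ-ring
    y'-split : addV u (embed y') ≗ addV x (scaleV M K)
    y'-split i = trans (cong (λ j → u i +ℚ ι j) (proj₂ (y'≡y+mk i)))
      (trans (cong (u i +ℚ_) (trans (ι-homo-+ (y i) (k i * + m)) (cong (ι (y i) +ℚ_) (ι-homo-* (k i) (+ m)))))
        (regroup (u i) (ι (y i)) (ι (k i)) M))
    distribute : ∀ β q M b r → β *ℚ ((q +ℚ M *ℚ b) +ℚ (M *ℚ M) *ℚ r) ≡
                               ((β *ℚ M) *ℚ b +ℚ ((β *ℚ M) *ℚ M) *ℚ r) +ℚ β *ℚ q
    distribute = solve-∀ ℚ-ring
    expand : β *ℚ Qf G (addV x (scaleV M K)) ≡ integral +ℚ β *ℚ Qf G x
    expand = trans (cong (β *ℚ_) (trans (Qf-add G G-sym x (scaleV M K))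
      (cong₂ _+ℚ_ (cong (Qf G x +ℚ_) (Bf-scaleʳ G M K x)) (Qf-scale G M K))))
      (distribute β (Qf G x) M (Bf G x K) (Qf G K))
    integral∈ℤ : IsInt integral
    integral∈ℤ = IsInt-+ (IsInt-* βm∈ℤ (InDual-add G u (embed y) u∈L♯ (InDual-embed G G-sym G-even y) k))
                         (IsInt-* (IsInt-* βm∈ℤ (+ m , refl)) (G-even k))

  χ∘Qf-scaled-add : ∀ {n} {G : Gram n} → Symmetric G → ∀ β s w → IsInt (β *ℚ s) → InDual G w → ∀ y →
                    χ (β *ℚ Qf G (addV (scaleV s w) (embed y))) ≈
                    χ (((β *ℚ s) *ℚ s) *ℚ Qf G w) *ᴿ χ (β *ℚ Qf G (embed y))
  χ∘Qf-scaled-add {G = G} G-sym β s w βs∈ℤ w∈L♯ y =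
    ≈-trans (≈-reflexive (cong χ (Qf-scaled-add G G-sym β s w (embed y))))
      (≈-trans (χ-add _ _) (*-cong ≈-refl (χ-IsInt-+ (β *ℚ Qf G (embed y)) (IsInt-* βs∈ℤ (w∈L♯ y)))))

proposition3p16 : {c ℓ : Level} (R : CommutativeRing c ℓ) (ch : Character R)
    (n : ℕ) → n ≥ 1 → (G : Gram n) → Symmetric G → Nondegenerate G → EvenIntegral G →
    (a b c d : ℤ) → a * d - b * c ≡ + 1 → d ≢ + 0 →
    (w : Fin n → ℚ) → InDual G w → InL (scaleV (ι (b * c)) w) →
    CommutativeRing._≈_ R
      (gaussSum R ch G b d w)
      (CommutativeRing._*_ R
        (Character.χ ch (ι (a * a * b * d) *ℚ Qf G w))
        (gaussSum R ch G b d (λ _ → ι (+ 0))))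
proposition3p16 R ch n _ G G-sym _ G-even a b c d ad-bc≡1 d≢0 w w∈L♯ (z , bcw≡z) = begin
  gaussSum R ch G b d w                                          ≈⟨ sumVecs-cong R n m (λ v → F-recentre (toℤⁿ v)) ⟩
  sumVecs R n m (λ v → F (zipWith _+_ (toℤⁿ v) (λ i → - z i)))   ≈⟨ sumVecs-shift R n m F F-periodic (λ i → - z i) ⟩
  sumVecs R n m (λ v → F (toℤⁿ v))                               ≈⟨ sumVecs-cong R n m (λ v → F-factor (toℤⁿ v)) ⟩
  sumVecs R n m (λ v → e-a²bdQw *ᴿ χ (β *ℚ Qf G (addV 0ⁿ (embed (toℤⁿ v)))))
                                                                 ≈⟨ *-distribˡ-sumVecs R n m _ _ ⟨
  e-a²bdQw *ᴿ gaussSum R ch G b d 0ⁿ                             ∎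
  where
  open CommutativeRing R using (_≈_; *-cong)
    renaming (Carrier to A; _*_ to _*ᴿ_; reflexive to ≈-reflexive; trans to ≈-trans)
  open import Relation.Binary.Reasoning.Setoid (CommutativeRing.setoid R)
  open Character ch using (χ)
  m : ℕ
  m = ∣ d ∣
  β : ℚ
  β = frac b d
  u : Fin n → ℚ
  u = scaleV (ι (a * d)) w
  0ⁿ : Fin n → ℚ
  0ⁿ _ = ι (+ 0)
  e-a²bdQw : A
  e-a²bdQw = χ (ι (a * a * b * d) *ℚ Qf G w)
  F : (Fin n → ℤ) → A
  F y = χ (β *ℚ Qf G (addV u (embed y)))
  F-recentre : ∀ y → χ (β *ℚ Qf G (addV w (embed y))) ≈ F (λ i → y i - z i)
  F-recentre y = ≈-reflexive (cong (λ q → χ (β *ℚ q)) (Qf-cong G (recentre (a * d) (b * c) w z ad-bc≡1 bcw≡z y)))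
  F-periodic : Periodic R m F
  F-periodic = χ∘Qf-periodic R ch G-sym G-even β m u (frac-*-ι∣∣-IsInt b d d≢0) (InDual-scale G (a * d) w w∈L♯)
  F-factor : ∀ y → F y ≈ e-a²bdQw *ᴿ χ (β *ℚ Qf G (addV 0ⁿ (embed y)))
  F-factor y = ≈-trans (χ∘Qf-scaled-add R ch G-sym β (ι (a * d)) w βad∈ℤ w∈L♯ y)
    (*-cong (≈-reflexive (cong (λ q → χ (q *ℚ Qf G w)) (frac-*-ι-multiple² a b d d≢0)))
            (≈-reflexive (cong (λ q → χ (β *ℚ q)) (Qf-cong G (λ i → sym (ℚP.+-identityˡ (ι (y i))))))))
    where
    βad∈ℤ : IsInt (β *ℚ ι (a * d))
    βad∈ℤ = a * b , frac-*-ι-multiple a b d d≢0
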